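{- Let $n$ be a positive integer, write $\mathbb{Z}_n=\{0,1,\dots,n-1\}$, and let $f:\mathbb{Z}_n\to\mathbb{Z}_n$ be any function. Then the following are equivalent: (i) $G_f$ is graceful, i.e. there exists a permutation $\sigma\in S_n$ of $\mathbb{Z}_n$ such that $\{\,|\sigma(f(i))-\sigma(i)| : i\in\mathbb{Z}_n\}=\mathbb{Z}_n$; (ii) there exist permutations $\sigma,\gamma\in S_n$ of $\mathbb{Z}_n$ and a function $p:\mathbb{Z}_n\to\{0,1\}$ such that \[ f(i)=\sigma\Big(\sigma^{ -1}(i)+(-1)^{p(\sigma^{ -1}(i))}\,\gamma\big(\sigma^{ -1}(i)\big)\Big)\quad\text{for all } i\in\mathbb{Z}_n. \]
   Context: $S_n$ denotes the symmetric group of all bijections $\mathbb{Z}_n\to\mathbb{Z}_n$. For $f:\mathbb{Z}_n\to\mathbb{Z}_n$, the functional directed graph $G_f$ has vertex set $\mathbb{Z}_n$ and edge set $\{(i,f(i)):i\in\mathbb{Z}_n\}$ (loops allowed). $G_f$ is called graceful if some relabeling $\sigma\in S_n$ of the vertices makes the set of induced edge labels $|\sigma(f(i))-\sigma(i)|$, $i\in\mathbb{Z}_n$, equal to all of $\mathbb{Z}_n$. -}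

module Defs where

open import Data.Nat using (ℕ)
open import Data.Fin using (Fin; toℕ)
open import Data.Fin.Permutation using (Permutation′; _⟨$⟩ʳ_; _⟨$⟩ˡ_)
open import Data.Integer using (ℤ; +_; _-_; _+_; _*_; ∣_∣; -1ℤ; _^_)
open import Data.Product using (Σ; _×_)
open import Relation.Binary.PropositionalEquality using (_≡_)

-- Z_n is modelled as Fin n, with elements read as the integers 0..n-1 via toℕ.

edgeLabel : ∀ {n} → (Fin n → Fin n) → Permutation′ n → Fin n → ℕ
edgeLabel f σ i = ∣ + toℕ (σ ⟨$⟩ʳ f i) - + toℕ (σ ⟨$⟩ʳ i) ∣

Graceful : ∀ {n} → (Fin n → Fin n) → Set
Graceful {n} f = Σ (Permutation′ n) λ σ →
  ((i : Fin n) → Σ (Fin n) λ k → edgeLabel f σ i ≡ toℕ k)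
  × ((k : Fin n) → Σ (Fin n) λ i → edgeLabel f σ i ≡ toℕ k)

-- Condition (ii): f(i) = σ(σ⁻¹(i) + (−1)^{p(σ⁻¹(i))} γ(σ⁻¹(i))) for all i, where the
-- argument of σ is computed in ℤ and must be an element of Z_n (= toℕ k for some k).
ConditionII : ∀ {n} → (Fin n → Fin n) → Set
ConditionII {n} f = Σ (Permutation′ n) λ σ → Σ (Permutation′ n) λ γ → Σ (Fin n → Fin 2) λ p →
  (i : Fin n) → Σ (Fin n) λ k →
    (+ toℕ (σ ⟨$⟩ˡ i) + (-1ℤ ^ toℕ (p (σ ⟨$⟩ˡ i))) * + toℕ (γ ⟨$⟩ʳ (σ ⟨$⟩ˡ i)) ≡ + toℕ k)
    × (f i ≡ σ ⟨$⟩ʳ k)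

module Submission where

-- Both conditions say that, after relabelling the vertices by a
-- permutation τ (in (ii) τ = σ⁻¹), the edge i ↦ f i gets a label, and that the
-- labels i ↦ ρ i form a permutation of Z_n.  Indeed, for vertex labels a, c and
-- a label g, "|c − a| = g" holds exactly when "c = a + (−1)^b g" for some sign
-- bit b; in (ii) the edge labels are γ(σ⁻¹ i) and the sign bits p(σ⁻¹ i).
--
-- This lets us
-- read a graceful labelling as a pair of permutations τ, ρ with
-- |τ(f i) − τ(i)| = ρ(i) ("GracefulBy").  Condition (ii) is then the same data
-- with σ = τ⁻¹, γ = ρ ∘ σ and p recording the sign of τ(f i) − τ(i).

open import Defs
open import Data.Nat using (ℕ; _≤_; suc)
import Data.Nat as ℕ
import Data.Nat.Properties as ℕ
open import Data.Fin using (Fin; toℕ; zero; suc; punchOut; _≟_)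
open import Data.Fin.Properties using (toℕ-injective; punchOut-injective; injective⇒≤; any?)
open import Data.Fin.Permutation
  using (Permutation′; _⟨$⟩ʳ_; _⟨$⟩ˡ_; permutation; flip; _∘ₚ_; inverseˡ; inverseʳ)
open import Data.Integer using (ℤ; +_; -[1+_]; _-_; _+_; _*_; ∣_∣; -1ℤ; _^_)
import Data.Integer.Properties as ℤ
open import Data.Integer.Solver using (module +-*-Solver)
open import Data.Product using (Σ; ∃; _,_; proj₁; proj₂)
open import Function using (_∘_)
open import Function.Bundles using (_⇔_; mk⇔)
open import Function.Definitions using (Injective)
open import Relation.Binary.PropositionalEquality
open import Relation.Nullary using (yes; no)
open import Relation.Nullary.Negation using (contradiction)

private
  variable
    n : ℕ

signBit : ℤ → Fin 2
signBit (+ _)    = zero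
signBit -[1+ _ ] = suc zero

signOf : Fin 2 → ℤ
signOf b = -1ℤ ^ toℕ b

signOf-signBit : ∀ d → signOf (signBit d) * + ∣ d ∣ ≡ d
signOf-signBit (+ m)    = ℤ.*-identityˡ (+ m)
signOf-signBit -[1+ m ] = ℤ.-1*i≡-i (+ suc m)

∣signOf∣ : ∀ b → ∣ signOf b ∣ ≡ 1
∣signOf∣ zero       = refl
∣signOf∣ (suc zero) = refl

signedStep-reaches : ∀ a c → a + signOf (signBit (c - a)) * + ∣ c - a ∣ ≡ c
signedStep-reaches a c = begin
  a + signOf (signBit (c - a)) * + ∣ c - a ∣ ≡⟨ cong (λ s → a + s) (signOf-signBit (c - a)) ⟩
  a + (c - a)                                 ≡⟨ a+[c-a]≡c a c ⟩
  c                                           ∎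
  where
  open ≡-Reasoning
  open +-*-Solver
  a+[c-a]≡c : ∀ a c → a + (c - a) ≡ c
  a+[c-a]≡c = solve 2 (λ a c → a :+ (c :- a) := c) refl

signedStep-length : ∀ a g c (b : Fin 2) → + a + signOf b * + g ≡ + c → ∣ + c - + a ∣ ≡ g
signedStep-length a g c b reaches = begin
  ∣ + c - + a ∣                        ≡⟨ cong (λ x → ∣ x - + a ∣) (sym reaches) ⟩
  ∣ (+ a + signOf b * + g) - + a ∣     ≡⟨ cong ∣_∣ ([a+s]-a≡s (+ a) (signOf b * + g)) ⟩
  ∣ signOf b * + g ∣                   ≡⟨ ℤ.abs-* (signOf b) (+ g) ⟩
  ∣ signOf b ∣ ℕ.* g                   ≡⟨ cong (ℕ._* g) (∣signOf∣ b) ⟩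
  1 ℕ.* g                              ≡⟨ ℕ.*-identityˡ g ⟩
  g                                    ∎
  where
  open ≡-Reasoning
  open +-*-Solver
  [a+s]-a≡s : ∀ a s → (a + s) - a ≡ s
  [a+s]-a≡s = solve 2 (λ a s → (a :+ s) :- a := s) refl

-- Pigeonhole: an injective endomap of Fin n is surjective, since if it missed
-- c, punching c out of its values would inject Fin n into Fin (n − 1).
injective⇒surjective : {g : Fin n → Fin n} → Injective _≡_ _≡_ g → ∀ c → ∃ λ k → g k ≡ c
injective⇒surjective {suc m} {g} g-injective c with any? (λ k → g k ≟ c)
... | yes hit  = hit
... | no ¬hit = contradiction (injective⇒≤ punched-injective) ℕ.1+n≰n
  where
  c≢g : ∀ k → c ≢ g k
  c≢g k c≡gk = ¬hit (k , sym c≡gk)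
  punched : Fin (suc m) → Fin m
  punched k = punchOut (c≢g k)
  punched-injective : Injective _≡_ _≡_ punched
  punched-injective {k} {l} eq = g-injective (punchOut-injective (c≢g k) (c≢g l) eq)

-- An endomap L of Fin n with a right inverse g is a permutation: g is
-- injective, hence surjective, hence also a left inverse of L.
fromRightInverse : (L g : Fin n → Fin n) → (∀ k → L (g k) ≡ k) → Permutation′ n
fromRightInverse L g L∘g≡id = permutation L g L∘g≡id g∘L≡id
  where
  g-injective : Injective _≡_ _≡_ g
  g-injective {k} {l} eq = trans (sym (L∘g≡id k)) (trans (cong L eq) (L∘g≡id l))
  g∘L≡id : ∀ x → g (L x) ≡ x
  g∘L≡id x with injective⇒surjective g-injective x
  ... | k , refl = cong g (L∘g≡id k)

GracefulBy : (Fin n → Fin n) → Permutation′ n → Permutation′ n → Set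
GracefulBy f τ ρ = ∀ i → edgeLabel f τ i ≡ toℕ (ρ ⟨$⟩ʳ i)

-- A labelling by a permutation is graceful: every label ρ(i) lies in Z_n and
-- the label k is attained at the edge ρ⁻¹(k).
gracefulBy⇒graceful : {f : Fin n → Fin n} (τ ρ : Permutation′ n) → GracefulBy f τ ρ → Graceful f
gracefulBy⇒graceful τ ρ labels =
  τ , (λ i → ρ ⟨$⟩ʳ i , labels i)
    , (λ k → ρ ⟨$⟩ˡ k , trans (labels (ρ ⟨$⟩ˡ k)) (cong toℕ (inverseʳ ρ)))

-- The edge labels of a graceful labelling hit every value exactly once: the
-- map from labels back to edges is a right inverse of the labelling map.
graceful⇒gracefulBy : {f : Fin n → Fin n} → Graceful f → Σ (Permutation′ n) λ τ → Σ (Permutation′ n) (GracefulBy f τ)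
graceful⇒gracefulBy (τ , labelOf , edgeWith) = τ , fromRightInverse L g L∘g≡id , proj₂ ∘ labelOf
  where
  L g : Fin _ → Fin _
  L = proj₁ ∘ labelOf
  g = proj₁ ∘ edgeWith
  L∘g≡id : ∀ k → L (g k) ≡ k
  L∘g≡id k = toℕ-injective (trans (sym (proj₂ (labelOf (g k)))) (proj₂ (edgeWith k)))

-- Under σ = τ⁻¹ and γ = ρ ∘ σ, condition (ii) at vertex i reads
-- τ(f i) = τ(i) ± ρ(i), with the sign of τ(f i) − τ(i).
gracefulBy⇒conditionII : {f : Fin n → Fin n} (τ ρ : Permutation′ n) → GracefulBy f τ ρ → ConditionII f
gracefulBy⇒conditionII {f = f} τ ρ labels =
  flip τ , flip τ ∘ₚ ρ , p , λ i → τ ⟨$⟩ʳ f i , reaches-at-τ i , sym (inverseˡ τ)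
  where
  step : Fin _ → ℤ
  step i = + toℕ (τ ⟨$⟩ʳ f i) - + toℕ (τ ⟨$⟩ʳ i)
  p : Fin _ → Fin 2
  p j = signBit (step (τ ⟨$⟩ˡ j))
  reaches : ∀ i → + toℕ (τ ⟨$⟩ʳ i) + signOf (signBit (step i)) * + toℕ (ρ ⟨$⟩ʳ i) ≡ + toℕ (τ ⟨$⟩ʳ f i)
  reaches i = subst (λ ℓ → + toℕ (τ ⟨$⟩ʳ i) + signOf (signBit (step i)) * + ℓ ≡ + toℕ (τ ⟨$⟩ʳ f i))
                    (labels i) (signedStep-reaches (+ toℕ (τ ⟨$⟩ʳ i)) (+ toℕ (τ ⟨$⟩ʳ f i)))
  -- The same equation, with p and γ evaluated at σ⁻¹(i) = τ(i) as (ii) demands.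
  reaches-at-τ : ∀ i → + toℕ (τ ⟨$⟩ʳ i) + signOf (p (τ ⟨$⟩ʳ i)) * + toℕ (ρ ⟨$⟩ʳ (τ ⟨$⟩ˡ (τ ⟨$⟩ʳ i)))
                       ≡ + toℕ (τ ⟨$⟩ʳ f i)
  reaches-at-τ i =
    subst (λ x → + toℕ (τ ⟨$⟩ʳ i) + signOf (signBit (step x)) * + toℕ (ρ ⟨$⟩ʳ x) ≡ + toℕ (τ ⟨$⟩ʳ f i))
          (sym (inverseˡ τ)) (reaches i)

conditionII⇒gracefulBy : {f : Fin n → Fin n} → ConditionII f → Σ (Permutation′ n) λ τ → Σ (Permutation′ n) (GracefulBy f τ)
conditionII⇒gracefulBy {f = f} (σ , γ , p , condition) = flip σ , flip σ ∘ₚ γ , labels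
  where
  labels : GracefulBy f (flip σ) (flip σ ∘ₚ γ)
  labels i with condition i
  ... | k , reaches , fi≡σk = begin
    ∣ + toℕ (σ ⟨$⟩ˡ f i) - + toℕ (σ ⟨$⟩ˡ i) ∣           ≡⟨ cong (λ x → ∣ + toℕ (σ ⟨$⟩ˡ x) - + toℕ (σ ⟨$⟩ˡ i) ∣) fi≡σk ⟩
    ∣ + toℕ (σ ⟨$⟩ˡ (σ ⟨$⟩ʳ k)) - + toℕ (σ ⟨$⟩ˡ i) ∣   ≡⟨ cong (λ x → ∣ + toℕ x - + toℕ (σ ⟨$⟩ˡ i) ∣) (inverseˡ σ) ⟩
    ∣ + toℕ k - + toℕ (σ ⟨$⟩ˡ i) ∣                      ≡⟨ signedStep-length _ _ _ (p (σ ⟨$⟩ˡ i)) reaches ⟩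
    toℕ (γ ⟨$⟩ʳ (σ ⟨$⟩ˡ i))                              ∎
    where open ≡-Reasoning

proposition1p1 : (n : ℕ) → 1 ≤ n → (f : Fin n → Fin n) → Graceful f ⇔ ConditionII f
proposition1p1 n _ f = mk⇔ to from
  where
  to : Graceful f → ConditionII f
  to graceful with graceful⇒gracefulBy graceful
  ... | τ , ρ , labels = gracefulBy⇒conditionII τ ρ labels
  from : ConditionII f → Graceful f
  from conditionII with conditionII⇒gracefulBy conditionII
  ... | τ , ρ , labels = gracefulBy⇒graceful τ ρ labels
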